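{- Let $G$ be a simple graph, let $k,u,v,c,k_1,k_2\in\mathbb{Z}$ and $d,m,n\in\mathbb{Z}^+$. In each of the following, assume that the quantity (or quantities) on the right-hand side exist. (1) If $[u]$ is a unit in $\mathbb{Z}_n$, then $\chi_{(n,uk)}(G) = \chi_{(n,k)}(G)$. (2) $\chi_{(n,vk)}(G) \leq \chi_{(n,k)}(G)$. (3) If $d$ is a common divisor of $k$ and $n$, then $\chi_{(n,k)}(G) \leq \chi_{(n/d,\, k/d)}(G)$. (4) If $m$ divides $n$, then $\chi_{(m, k)}(G) \leq \chi_{(n,k)}(G)$. (5) If $G$ admits a constant labeling that is an open coloring with remainder $c \bmod n$, then $\chi_{(n,k - c)}(G) = \chi_{(n,k)}(G)$. (6) $\chi_{(n,k_1+k_2)}(G) \leq \chi_{(n,k_1)}(G)\, \chi_{(n,k_2)}(G)$.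
   Context: For a graph $G=(V,E)$, a $\mathbb{Z}$-labeling is a map $\ell:V\to\mathbb{Z}$; its order is the size of its range; it is proper if adjacent vertices get different labels; $\chi(G)$ is the minimum order of a proper labeling. $N(v)$ is the open neighborhood of $v$ (its neighbors, excluding $v$). For $k\in\mathbb{Z}$, $n\in\mathbb{Z}^+$, an open coloring with remainder $k \bmod n$ is a labeling with $\sum_{w\in N(v)}\ell(w)\equiv k \pmod n$ for all $v\in V$. If no proper such coloring exists, $\chi_{(n,k)}(G)$ does not exist; if proper such colorings of finite order exist, $\chi_{(n,k)}(G)$ is the minimum order of one; if they exist only of infinite order, $\chi_{(n,k)}(G)=\infty$. $[u]$ denotes the image of $u$ in $\mathbb{Z}_n$. -}

module Defs where

open import Level using (0ℓ)
open import Data.Nat using (ℕ; _*_; _<_)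
open import Data.Integer as ℤ using (ℤ; +_; _-_; _+_; 0ℤ)
open import Data.Integer.Divisibility using (_∣_)
open import Data.Fin using (Fin)
open import Data.List using (List; map; foldr)
open import Data.List.Membership.Propositional using (_∈_)
open import Data.List.Relation.Unary.Unique.Propositional using (Unique)
open import Data.Product using (Σ; ∃; _×_; _,_)
open import Function.Bundles using (_⇔_)
open import Relation.Nullary using (¬_)
open import Relation.Binary.PropositionalEquality using (_≡_; _≢_)

-- A simple (possibly infinite) graph, locally finite so that neighbourhood
-- sums make sense.  nbrs v is a duplicate-free list enumerating N(v).
record SimpleGraph : Set₁ where
  field
    V       : Set
    Adj     : V → V → Set
    sym     : ∀ {v w} → Adj v w → Adj w v
    irrefl  : ∀ {v} → ¬ Adj v v
    nbrs    : V → List V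
    nbrs-unique : ∀ v → Unique (nbrs v)
    nbrs-spec   : ∀ v w → (w ∈ nbrs v) ⇔ Adj v w

open SimpleGraph public

_≡_[mod_] : ℤ → ℤ → ℕ → Set
a ≡ b [mod n ] = (+ n) ∣ (a - b)

Labeling : SimpleGraph → Set
Labeling G = V G → ℤ

sumℤ : List ℤ → ℤ
sumℤ = foldr _+_ 0ℤ

nbrSum : (G : SimpleGraph) → Labeling G → V G → ℤ
nbrSum G ℓ v = sumℤ (map ℓ (nbrs G v))

Proper : (G : SimpleGraph) → Labeling G → Set
Proper G ℓ = ∀ v w → Adj G v w → ℓ v ≢ ℓ w

OpenColoring : (G : SimpleGraph) → ℕ → ℤ → Labeling G → Set
OpenColoring G n k ℓ = ∀ v → nbrSum G ℓ v ≡ k [mod n ]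

OrderAtMost : (G : SimpleGraph) → Labeling G → ℕ → Set
OrderAtMost G ℓ r = Σ (Fin r → ℤ) λ f → ∀ v → ∃ λ i → ℓ v ≡ f i

ChiExists : SimpleGraph → ℕ → ℤ → Set
ChiExists G n k = ∃ λ ℓ → Proper G ℓ × OpenColoring G n k ℓ

ChiAtMost : SimpleGraph → ℕ → ℤ → ℕ → Set
ChiAtMost G n k r = ∃ λ ℓ → Proper G ℓ × OpenColoring G n k ℓ × OrderAtMost G ℓ r

-- "χ_(n₁,k₁)(G) ≤ χ_(n₂,k₂)(G), assuming the right-hand side exists",
-- with values in ℕ ∪ {∞}, unfolded constructively:
--  * if the RHS exists then so does the LHS, and
--  * every finite bound attained by the RHS is attained by the LHS.
ChiLE : SimpleGraph → ℕ → ℤ → ℕ → ℤ → Set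
ChiLE G n₁ k₁ n₂ k₂ =
  (ChiExists G n₂ k₂ → ChiExists G n₁ k₁) ×
  (∀ r → ChiAtMost G n₂ k₂ r → ChiAtMost G n₁ k₁ r)

ChiEq : SimpleGraph → ℕ → ℤ → ℕ → ℤ → Set
ChiEq G n₁ k₁ n₂ k₂ = ChiLE G n₁ k₁ n₂ k₂ × ChiLE G n₂ k₂ n₁ k₁

ChiLEProd : SimpleGraph → ℕ → ℤ → ℤ → Set
ChiLEProd G n k₁ k₂ =
  (ChiExists G n k₁ → ChiExists G n k₂ → ChiExists G n (k₁ + k₂)) ×
  (∀ r₁ r₂ → ChiAtMost G n k₁ r₁ → ChiAtMost G n k₂ r₂ →
     ChiAtMost G n (k₁ + k₂) (r₁ * r₂))

IsUnitMod : ℕ → ℤ → Set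
IsUnitMod n u = ∃ λ w → (u ℤ.* w) ≡ (+ 1) [mod n ]

ConstOpenColoring : SimpleGraph → ℕ → ℤ → Set
ConstOpenColoring G n c = ∃ λ (a : ℤ) → OpenColoring G n c (λ _ → a)

{-# OPTIONS --safe #-}
-- Each inequality comes from a map on labels that is injective, so it keeps
-- colorings proper and does not increase their order, and that is linear
-- enough to move the remainder as required: multiplying by a nonzero integer
-- congruent to u, v or w (where u w ≡ 1), multiplying by d, the identity, and
-- adding ± the constant labeling.  For the product, the labels a and b are
-- paired as ((a + b) mod n) + a n, which is congruent to a + b and from which
-- a can be read off.
module Submission where

open import Defs
open import Data.Nat as ℕ using (ℕ; _<_; NonZero; >-nonZero)
open import Data.Integer using (ℤ; +_; _*_; _+_; _-_)
open import Data.Product using (_×_)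
open import Relation.Binary.PropositionalEquality using (_≡_)

open import Level using (0ℓ)
open import Data.Integer as ℤ using (+0; +[1+_]; -[1+_]; -_; 0ℤ; ∣_∣; _⊖_)
import Data.Integer.Properties as ℤ
open import Algebra.Properties.Ring ℤ.+-*-ring using (+-cancelʳ)
import Data.Nat.Properties as ℕ
import Data.Nat.Divisibility as ℕ
open import Data.Integer.Divisibility.Signed using (divides; ∣ᵤ⇒∣; ∣⇒∣ᵤ)
  renaming (_∣_ to _∣ₛ_)
import Data.Integer.Divisibility.Signed as Signed
import Data.Integer.Divisibility as ℤ∣
open import Data.Integer.DivMod using (_%ℕ_; _/ℕ_; a≡a%ℕn+[a/ℕn]*n; n%ℕd<d)
open import Data.Integer.Tactic.RingSolver using (solve-∀)
open import Data.Fin using (Fin; combine; remQuot)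
open import Data.Fin.Properties using (remQuot-combine)
open import Data.List using ([]; _∷_; map)
open import Data.Product using (_,_; uncurry)
open import Function using (id; _∘_; _$_)
open import Function.Definitions using (Injective)
open import Relation.Binary.Bundles using (Setoid)
import Relation.Binary.Reasoning.Setoid
open import Relation.Binary.PropositionalEquality as ≡
  using (refl; trans; cong; cong₂; subst; subst₂; module ≡-Reasoning)

-- Defs' congruence unfolds to a divisibility of ∣ a - b ∣, from which Agda
-- cannot infer a and b; the wrapper makes them inferable.
record _≋_[mod_] (a b : ℤ) (n : ℕ) : Set where
  constructor wrap
  field unwrap : a ≡ b [mod n ]

open _≋_[mod_]

private
  *-distribˡ-minus : ∀ c a b → c * (a - b) ≡ c * a - c * b
  *-distribˡ-minus = solve-∀

module _ {n : ℕ} where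

  private
    toSigned : ∀ {a b} → a ≋ b [mod n ] → + n ∣ₛ a - b
    toSigned = ∣ᵤ⇒∣ ∘ unwrap

    fromSigned : ∀ {a b} → + n ∣ₛ a - b → a ≋ b [mod n ]
    fromSigned = wrap ∘ ∣⇒∣ᵤ

    ∣ₛ-resp : ∀ {x y} → x ≡ y → + n ∣ₛ x → + n ∣ₛ y
    ∣ₛ-resp = subst (+ n ∣ₛ_)

  ≋-refl : ∀ {a} → a ≋ a [mod n ]
  ≋-refl {a} = fromSigned (divides 0ℤ (trans (ℤ.+-inverseʳ a) (≡.sym (ℤ.*-zeroˡ (+ n)))))

  ≋-sym : ∀ {a b} → a ≋ b [mod n ] → b ≋ a [mod n ]
  ≋-sym {a} {b} (wrap a≡b) = wrap (subst (n ℕ.∣_) (ℤ.∣i-j∣≡∣j-i∣ a b) a≡b)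

  ≋-trans : ∀ {a b c} → a ≋ b [mod n ] → b ≋ c [mod n ] → a ≋ c [mod n ]
  ≋-trans {a} {b} {c} a≋b b≋c = fromSigned $ ∣ₛ-resp (ℤ.+-minus-telescope a b c)
    (Signed.∣m∣n⇒∣m+n (toSigned a≋b) (toSigned b≋c))

  ≋-setoid : Setoid 0ℓ 0ℓ
  ≋-setoid = record
    { Carrier = ℤ
    ; _≈_ = _≋_[mod n ]
    ; isEquivalence = record { refl = ≋-refl ; sym = ≋-sym ; trans = ≋-trans }
    }

  ≋-+ : ∀ {a b c d} → a ≋ b [mod n ] → c ≋ d [mod n ] → (a + c) ≋ (b + d) [mod n ]
  ≋-+ {a} {b} {c} {d} a≋b c≋d = fromSigned $ ∣ₛ-resp (regroup a b c d)
    (Signed.∣m∣n⇒∣m+n (toSigned a≋b) (toSigned c≋d))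
    where
    regroup : ∀ a b c d → (a - b) + (c - d) ≡ (a + c) - (b + d)
    regroup = solve-∀

  ≋-neg : ∀ {a b} → a ≋ b [mod n ] → (- a) ≋ (- b) [mod n ]
  ≋-neg {a} {b} a≋b = fromSigned $ ∣ₛ-resp (neg-minus a b) (Signed.∣m⇒∣-m (toSigned a≋b))
    where
    neg-minus : ∀ a b → - (a - b) ≡ - a - - b
    neg-minus = solve-∀

  ≋-*ˡ : ∀ c {a b} → a ≋ b [mod n ] → (c * a) ≋ (c * b) [mod n ]
  ≋-*ˡ c {a} {b} a≋b =
    fromSigned $ ∣ₛ-resp (*-distribˡ-minus c a b) (Signed.∣n⇒∣m*n c (toSigned a≋b))

  ≋-*ʳ : ∀ c {a b} → a ≋ b [mod n ] → (a * c) ≋ (b * c) [mod n ]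
  ≋-*ʳ c {a} {b} a≋b =
    subst₂ (_≋_[mod n ]) (ℤ.*-comm c a) (ℤ.*-comm c b) (≋-*ˡ c a≋b)

  i+j*n≋i : ∀ i j → (i + j * + n) ≋ i [mod n ]
  i+j*n≋i i j = fromSigned (divides j (cancel i (j * + n)))
    where
    cancel : ∀ i m → (i + m) - i ≡ m
    cancel = solve-∀

≋-*-modulus : ∀ d {n a b} → a ≋ b [mod n ] → (+ d * a) ≋ (+ d * b) [mod d ℕ.* n ]
≋-*-modulus d {n} {a} {b} (wrap n∣a-b) = wrap $
  subst₂ ℤ∣._∣_ (≡.sym (ℤ.pos-* d n)) (*-distribˡ-minus (+ d) a b) (ℤ∣.*-monoʳ-∣ (+ d) n∣a-b)

≋-∣-modulus : ∀ {m n a b} → m ℕ.∣ n → a ≋ b [mod n ] → a ≋ b [mod m ]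
≋-∣-modulus m∣n (wrap n∣∣a-b∣) = wrap (ℕ.∣-trans m∣n n∣∣a-b∣)

module ≋-Reasoning (n : ℕ) = Relation.Binary.Reasoning.Setoid (≋-setoid {n})

module _ {A : Set} where

  sumℤ-map-+ : ∀ (f g : A → ℤ) xs →
    sumℤ (map (λ x → f x + g x) xs) ≡ sumℤ (map f xs) + sumℤ (map g xs)
  sumℤ-map-+ f g []       = refl
  sumℤ-map-+ f g (x ∷ xs) = trans (cong (_+_ (f x + g x)) (sumℤ-map-+ f g xs))
    (interchange (f x) (g x) (sumℤ (map f xs)) (sumℤ (map g xs)))
    where
    interchange : ∀ a b c d → (a + b) + (c + d) ≡ (a + c) + (b + d)
    interchange = solve-∀

  sumℤ-map-* : ∀ c (f : A → ℤ) xs → sumℤ (map (λ x → c * f x) xs) ≡ c * sumℤ (map f xs)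
  sumℤ-map-* c f []       = ≡.sym (ℤ.*-zeroʳ c)
  sumℤ-map-* c f (x ∷ xs) = trans (cong (_+_ (c * f x)) (sumℤ-map-* c f xs))
    (≡.sym (ℤ.*-distribˡ-+ c (f x) (sumℤ (map f xs))))

  sumℤ-map-neg : ∀ (f : A → ℤ) xs → sumℤ (map (λ x → - f x) xs) ≡ - sumℤ (map f xs)
  sumℤ-map-neg f []       = refl
  sumℤ-map-neg f (x ∷ xs) = trans (cong (_+_ (- f x)) (sumℤ-map-neg f xs))
    (≡.sym (ℤ.neg-distrib-+ (f x) (sumℤ (map f xs))))

  sumℤ-map-≋ : ∀ {n} {f g : A → ℤ} → (∀ x → f x ≋ g x [mod n ]) →
    ∀ xs → sumℤ (map f xs) ≋ sumℤ (map g xs) [mod n ]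
  sumℤ-map-≋ f≋g []       = ≋-refl
  sumℤ-map-≋ f≋g (x ∷ xs) = ≋-+ (f≋g x) (sumℤ-map-≋ f≋g xs)

proper-zipWith : ∀ G (φ : ℤ → ℤ → ℤ) → (∀ {a b a′ b′} → φ a b ≡ φ a′ b′ → a ≡ a′) →
  ∀ {ℓ₁ ℓ₂ : Labeling G} → Proper G ℓ₁ → Proper G (λ v → φ (ℓ₁ v) (ℓ₂ v))
proper-zipWith G φ φ-injectiveˡ ℓ₁-proper v w v~w = ℓ₁-proper v w v~w ∘ φ-injectiveˡ

proper-map : ∀ G {f : ℤ → ℤ} → Injective _≡_ _≡_ f → ∀ {ℓ} → Proper G ℓ → Proper G (f ∘ ℓ)
proper-map G f-injective ℓ-proper v w v~w = ℓ-proper v w v~w ∘ f-injective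

orderAtMost-map : ∀ G (f : ℤ → ℤ) {ℓ r} → OrderAtMost G ℓ r → OrderAtMost G (f ∘ ℓ) r
orderAtMost-map G f (labels , ℓ∈) =
  f ∘ labels , λ v → let (i , ℓv≡) = ℓ∈ v in i , cong f ℓv≡

orderAtMost-zipWith : ∀ G (φ : ℤ → ℤ → ℤ) {ℓ₁ ℓ₂ r₁ r₂} →
  OrderAtMost G ℓ₁ r₁ → OrderAtMost G ℓ₂ r₂ →
  OrderAtMost G (λ v → φ (ℓ₁ v) (ℓ₂ v)) (r₁ ℕ.* r₂)
orderAtMost-zipWith G φ {r₁ = r₁} {r₂} (labels₁ , ℓ₁∈) (labels₂ , ℓ₂∈) =
  uncurry label ∘ remQuot {r₁} r₂ , λ v →
    let (i₁ , ℓ₁v≡) = ℓ₁∈ v ; (i₂ , ℓ₂v≡) = ℓ₂∈ v in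
    combine i₁ i₂ , trans (cong₂ φ ℓ₁v≡ ℓ₂v≡)
                          (cong (uncurry label) (≡.sym (remQuot-combine i₁ i₂)))
  where
  label : Fin r₁ → Fin r₂ → ℤ
  label i₁ i₂ = φ (labels₁ i₁) (labels₂ i₂)

chiLE-map : ∀ G {n₁ k₁ n₂ k₂} (f : ℤ → ℤ) → Injective _≡_ _≡_ f →
  (∀ ℓ → (∀ v → nbrSum G ℓ v ≋ k₂ [mod n₂ ]) → ∀ v → nbrSum G (f ∘ ℓ) v ≋ k₁ [mod n₁ ]) →
  ChiLE G n₁ k₁ n₂ k₂
chiLE-map G {n₁} {k₁} {n₂} {k₂} f f-injective preserves =
  (λ (ℓ , ℓ-proper , ℓ-open) → f ∘ ℓ , proper-map G f-injective ℓ-proper , transfer ℓ ℓ-open) ,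
  λ r (ℓ , ℓ-proper , ℓ-open , order) →
    f ∘ ℓ , proper-map G f-injective ℓ-proper , transfer ℓ ℓ-open , orderAtMost-map G f order
  where
  transfer : ∀ ℓ → OpenColoring G n₂ k₂ ℓ → OpenColoring G n₁ k₁ (f ∘ ℓ)
  transfer ℓ ℓ-open = unwrap ∘ preserves ℓ (wrap ∘ ℓ-open)

chiLEProd-pairing : ∀ G n k₁ k₂ (φ : ℤ → ℤ → ℤ) →
  (∀ {a b a′ b′} → φ a b ≡ φ a′ b′ → a ≡ a′) →
  (∀ a b → φ a b ≋ (a + b) [mod n ]) →
  ChiLEProd G n k₁ k₂
chiLEProd-pairing G n k₁ k₂ φ φ-injectiveˡ φ≋+ =
  (λ (ℓ₁ , ℓ₁-proper , ℓ₁-open) (ℓ₂ , _ , ℓ₂-open) →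
    pair ℓ₁ ℓ₂ , proper-zipWith G φ φ-injectiveˡ ℓ₁-proper , pair-open ℓ₁ ℓ₂ ℓ₁-open ℓ₂-open) ,
  λ r₁ r₂ (ℓ₁ , ℓ₁-proper , ℓ₁-open , order₁) (ℓ₂ , _ , ℓ₂-open , order₂) →
    pair ℓ₁ ℓ₂ , proper-zipWith G φ φ-injectiveˡ ℓ₁-proper , pair-open ℓ₁ ℓ₂ ℓ₁-open ℓ₂-open ,
    orderAtMost-zipWith G φ order₁ order₂
  where
  pair : Labeling G → Labeling G → Labeling G
  pair ℓ₁ ℓ₂ v = φ (ℓ₁ v) (ℓ₂ v)

  pair-open : ∀ ℓ₁ ℓ₂ → OpenColoring G n k₁ ℓ₁ → OpenColoring G n k₂ ℓ₂ →
    OpenColoring G n (k₁ + k₂) (pair ℓ₁ ℓ₂)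
  pair-open ℓ₁ ℓ₂ ℓ₁-open ℓ₂-open v = unwrap $ begin
    nbrSum G (pair ℓ₁ ℓ₂) v                   ≈⟨ sumℤ-map-≋ (λ w → φ≋+ (ℓ₁ w) (ℓ₂ w)) (nbrs G v) ⟩
    sumℤ (map (λ w → ℓ₁ w + ℓ₂ w) (nbrs G v)) ≡⟨ sumℤ-map-+ ℓ₁ ℓ₂ (nbrs G v) ⟩
    nbrSum G ℓ₁ v + nbrSum G ℓ₂ v             ≈⟨ ≋-+ ℓ₁-open≋ ℓ₂-open≋ ⟩
    k₁ + k₂                                   ∎
    where
    open ≋-Reasoning n
    ℓ₁-open≋ : nbrSum G ℓ₁ v ≋ k₁ [mod n ]
    ℓ₁-open≋ = wrap (ℓ₁-open v)
    ℓ₂-open≋ : nbrSum G ℓ₂ v ≋ k₂ [mod n ]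
    ℓ₂-open≋ = wrap (ℓ₂-open v)

-- Multiplying labels by c itself is not injective when c = 0.
nonzeroRep : ℕ → ℤ → ℤ
nonzeroRep n +0           = + n
nonzeroRep n c@(+[1+ _ ]) = c
nonzeroRep n c@(-[1+ _ ]) = c

nonzeroRep-nonZero : ∀ n {{_ : NonZero n}} c → ℤ.NonZero (nonzeroRep n c)
nonzeroRep-nonZero n {{n≢0}} +0 = n≢0
nonzeroRep-nonZero n +[1+ _ ]    = _
nonzeroRep-nonZero n -[1+ _ ]    = _

nonzeroRep-≋ : ∀ n c → nonzeroRep n c ≋ c [mod n ]
nonzeroRep-≋ n +0       = wrap (ℕ.divides 1 refl)
nonzeroRep-≋ n +[1+ _ ] = ≋-refl
nonzeroRep-≋ n -[1+ _ ] = ≋-refl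

chiLE-scale : ∀ G n {{_ : NonZero n}} c {t k} → (c * t) ≋ k [mod n ] → ChiLE G n k n t
chiLE-scale G n c {t} {k} ct≋k = chiLE-map G (c′ *_) (ℤ.*-cancelˡ-≡ c′ _ _) scaled
  where
  c′ = nonzeroRep n c
  instance _ = nonzeroRep-nonZero n c
  scaled : ∀ ℓ → (∀ v → nbrSum G ℓ v ≋ t [mod n ]) →
    ∀ v → nbrSum G ((c′ *_) ∘ ℓ) v ≋ k [mod n ]
  scaled ℓ ℓ-open v = begin
    nbrSum G (λ w → c′ * ℓ w) v ≡⟨ sumℤ-map-* c′ ℓ (nbrs G v) ⟩
    c′ * nbrSum G ℓ v           ≈⟨ ≋-*ˡ c′ (ℓ-open v) ⟩
    c′ * t                      ≈⟨ ≋-*ʳ t (nonzeroRep-≋ n c) ⟩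
    c * t                       ≈⟨ ct≋k ⟩
    k                           ∎
    where open ≋-Reasoning n

chiEq-unit : ∀ G n {{_ : NonZero n}} k u → IsUnitMod n u → ChiEq G n (u * k) n k
chiEq-unit G n k u (w , uw≡1) = chiLE-scale G n u ≋-refl , chiLE-scale G n w w*uk≋k
  where
  w*uk≋k : (w * (u * k)) ≋ k [mod n ]
  w*uk≋k = begin
    w * (u * k) ≡⟨ ℤ.*-assoc w u k ⟨
    (w * u) * k ≡⟨ cong (_* k) (ℤ.*-comm w u) ⟩
    (u * w) * k ≈⟨ ≋-*ʳ k uw≋1 ⟩
    + 1 * k     ≡⟨ ℤ.*-identityˡ k ⟩
    k           ∎
    where
    open ≋-Reasoning n
    uw≋1 : (u * w) ≋ + 1 [mod n ]
    uw≋1 = wrap uw≡1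

chiLE-*-modulus : ∀ G d {{_ : NonZero d}} n k → ChiLE G (d ℕ.* n) (+ d * k) n k
chiLE-*-modulus G d n k = chiLE-map G (+ d *_) (ℤ.*-cancelˡ-≡ (+ d) _ _) scaled
  where
  scaled : ∀ ℓ → (∀ v → nbrSum G ℓ v ≋ k [mod n ]) →
    ∀ v → nbrSum G ((+ d *_) ∘ ℓ) v ≋ + d * k [mod d ℕ.* n ]
  scaled ℓ ℓ-open v = begin
    nbrSum G (λ w → + d * ℓ w) v ≡⟨ sumℤ-map-* (+ d) ℓ (nbrs G v) ⟩
    + d * nbrSum G ℓ v           ≈⟨ ≋-*-modulus d (ℓ-open v) ⟩
    + d * k                      ∎
    where open ≋-Reasoning (d ℕ.* n)

chiLE-∣-modulus : ∀ G {m n} k → m ℕ.∣ n → ChiLE G m k n k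
chiLE-∣-modulus G k m∣n = chiLE-map G id id (λ _ ℓ-open → ≋-∣-modulus m∣n ∘ ℓ-open)

openColoring-neg : ∀ G n k ℓ → OpenColoring G n k ℓ → OpenColoring G n (- k) (λ v → - ℓ v)
openColoring-neg G n k ℓ ℓ-open v = unwrap $ begin
  sumℤ (map (λ w → - ℓ w) (nbrs G v)) ≡⟨ sumℤ-map-neg ℓ (nbrs G v) ⟩
  - nbrSum G ℓ v                      ≈⟨ ≋-neg (wrap (ℓ-open v)) ⟩
  - k                                 ∎
  where open ≋-Reasoning n

chiLE-shift : ∀ G n k (a c : ℤ) → OpenColoring G n c (λ _ → a) → ChiLE G n (k + c) n k
chiLE-shift G n k a c a-open = chiLE-map G (_+ a) (+-cancelʳ a _ _) shifted
  where
  shifted : ∀ ℓ → (∀ v → nbrSum G ℓ v ≋ k [mod n ]) →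
    ∀ v → nbrSum G ((_+ a) ∘ ℓ) v ≋ k + c [mod n ]
  shifted ℓ ℓ-open v = begin
    nbrSum G (λ w → ℓ w + a) v          ≡⟨ sumℤ-map-+ ℓ (λ _ → a) (nbrs G v) ⟩
    nbrSum G ℓ v + nbrSum G (λ _ → a) v ≈⟨ ≋-+ (ℓ-open v) (wrap (a-open v)) ⟩
    k + c                               ∎
    where open ≋-Reasoning n

chiEq-shift : ∀ G n k (a c : ℤ) → OpenColoring G n c (λ _ → a) → ChiEq G n (k - c) n k
chiEq-shift G n k a c a-open =
  chiLE-shift G n k (- a) (- c) (openColoring-neg G n c (λ _ → a) a-open) ,
  subst (λ j → ChiLE G n j n (k - c)) (minus-plus k c) (chiLE-shift G n (k - c) a c a-open)
  where
  minus-plus : ∀ k c → (k - c) + c ≡ k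
  minus-plus = solve-∀

quotient-unique : ∀ n {r r′ q q′} → r < n → r′ < n → + r + q * + n ≡ + r′ + q′ * + n → q ≡ q′
quotient-unique n {r} {r′} {q} {q′} r<n r′<n eq =
  ℤ.i-j≡0⇒i≡j q q′ (ℤ.∣i∣≡0⇒i≡0 (ℕ.n<1⇒n≡0 (ℕ.*-cancelʳ-< n _ _ ∣q-q′∣*n<1*n)))
  where
  [q-q′]*n≡r′-r : (q - q′) * + n ≡ + r′ - + r
  [q-q′]*n≡r′-r = begin
    (q - q′) * + n                       ≡⟨ difference (+ r) q q′ (+ n) ⟩
    (+ r + q * + n) - (+ r + q′ * + n)   ≡⟨ cong (_- (+ r + q′ * + n)) eq ⟩
    (+ r′ + q′ * + n) - (+ r + q′ * + n) ≡⟨ cancel (+ r′) (+ r) (q′ * + n) ⟩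
    + r′ - + r                           ∎
    where
    open ≡-Reasoning
    difference : ∀ r q q′ n → (q - q′) * n ≡ (r + q * n) - (r + q′ * n)
    difference = solve-∀
    cancel : ∀ r′ r m → (r′ + m) - (r + m) ≡ r′ - r
    cancel = solve-∀

  ∣q-q′∣*n<1*n : ∣ q - q′ ∣ ℕ.* n < 1 ℕ.* n
  ∣q-q′∣*n<1*n = begin-strict
    ∣ q - q′ ∣ ℕ.* n   ≡⟨ ℤ.abs-* (q - q′) (+ n) ⟨
    ∣ (q - q′) * + n ∣ ≡⟨ cong ∣_∣ (trans [q-q′]*n≡r′-r (ℤ.[+m]-[+n]≡m⊖n r′ r)) ⟩
    ∣ r′ ⊖ r ∣         ≤⟨ ℤ.∣m⊝n∣≤m⊔n r′ r ⟩
    r′ ℕ.⊔ r           <⟨ ℕ.⊔-lub r′<n r<n ⟩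
    n                  ≡⟨ ℕ.*-identityˡ n ⟨
    1 ℕ.* n            ∎
    where open ℕ.≤-Reasoning

module _ (n : ℕ) {{_ : NonZero n}} where

  pairMod : ℤ → ℤ → ℤ
  pairMod a b = + ((a + b) %ℕ n) + a * + n

  pairMod-injectiveˡ : ∀ {a b a′ b′} → pairMod a b ≡ pairMod a′ b′ → a ≡ a′
  pairMod-injectiveˡ {a} {b} {a′} {b′} =
    quotient-unique n (n%ℕd<d (a + b) n) (n%ℕd<d (a′ + b′) n)

  pairMod-≋ : ∀ a b → pairMod a b ≋ (a + b) [mod n ]
  pairMod-≋ a b = begin
    + r + a * + n            ≈⟨ i+j*n≋i (+ r) a ⟩
    + r                      ≈⟨ i+j*n≋i (+ r) ((a + b) /ℕ n) ⟨
    + r + (a + b) /ℕ n * + n ≡⟨ a≡a%ℕn+[a/ℕn]*n (a + b) n ⟨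
    a + b                    ∎
    where
    open ≋-Reasoning n
    r = (a + b) %ℕ n

theorem5p3 : (G : SimpleGraph) (k u v c k₁ k₂ : ℤ) (d m n : ℕ) →
    0 < d → 0 < m → 0 < n →
    (IsUnitMod n u → ChiEq G n (u * k) n k)
    × ChiLE G n (v * k) n k
    × ((n' : ℕ) (k' : ℤ) → n ≡ d ℕ.* n' → k ≡ (+ d) * k' →
         ChiLE G n k n' k')
    × ((q : ℕ) → n ≡ m ℕ.* q → ChiLE G m k n k)
    × (ConstOpenColoring G n c → ChiEq G n (k - c) n k)
    × ChiLEProd G n k₁ k₂
theorem5p3 G k u v c k₁ k₂ d m n 0<d _ 0<n =
    chiEq-unit G n k u
  , chiLE-scale G n v ≋-refl
  , (λ { n′ k′ refl refl → chiLE-*-modulus G d n′ k′ })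
  , (λ { q refl → chiLE-∣-modulus G k (ℕ.m∣m*n q) })
  , (λ (a , a-open) → chiEq-shift G n k a c a-open)
  , chiLEProd-pairing G n k₁ k₂ (pairMod n) (pairMod-injectiveˡ n) (pairMod-≋ n)
  where
  instance
    _ = >-nonZero 0<d
    _ = >-nonZero 0<n
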